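{- Let $t$ be a positive integer and let $\mathcal A\in I(n,t)$ be maximal and fixed. Then $\mathrm{fix}(\mathcal A)=\{\mathrm{fix}(\sigma):\sigma\in\mathcal A\}$ is a generating set for $\mathcal A$.
   Context: $S_n$ is the symmetric group on $[n]=\{1,\dots,n\}$; $\mathrm{fix}(\sigma)=\{x:\sigma(x)=x\}$. Two permutations have a cycle in common if that cycle appears in both cycle decompositions (1-cycles count). A family $\mathcal A\subseteq S_n$ is $t$-cycle-intersecting if any two distinct members have at least $t$ cycles in common; $I(n,t)$ is the collection of all such families. $\mathcal A\in I(n,t)$ is maximal if for every $\sigma\in S_n\setminus\mathcal A$, $\mathcal A\cup\{\sigma\}$ is not $t$-cycle-intersecting. For $i\neq j$ and $\sigma\in S_n$, the $ij$-fixing ${}_{[ij]}\sigma$ is: $\sigma$ if $\sigma(i)\neq j$; if $\sigma(i)=j$, then ${}_{[ij]}\sigma(i)=i$, ${}_{[ij]}\sigma(\sigma^{ -1}(i))=j$, and ${}_{[ij]}\sigma(x)=\sigma(x)$ otherwise. $\triangleleft_{ij}(\mathcal A)=\{\triangleleft_{ij}(\sigma):\sigma\in\mathcal A\}$ where $\triangleleft_{ij}(\sigma)={}_{[ij]}\sigma$ if ${}_{[ij]}\sigma\notin\mathcal A$ and $\sigma$ otherwise; $\mathcal A$ is fixed if $\triangleleft_{ij}(\mathcal A)=\mathcal A$ for all $i\neq j$. For $B\subseteq[n]$, $\mathscr U_p(B)=\{\sigma\in S_n: B\subseteq\mathrm{fix}(\sigma)\}$, and for a collection $\mathcal B$ of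 subsets, $\mathscr U_p(\mathcal B)=\bigcup_{B\in\mathcal B}\mathscr U_p(B)$. A collection $g$ of subsets of $[n]$ is a generating set for $\mathcal A\subseteq S_n$ if $g$ contains no set of cardinality $n-1$ and $\mathscr U_p(g)=\mathcal A$. -}

module Defs where

open import Level using (0ℓ)
open import Data.Nat using (ℕ; zero; suc)
open import Data.Bool using (Bool; true; false; T; if_then_else_; _∧_)
open import Data.Fin using (Fin; _≟_)
open import Data.Fin.Subset using (Subset; _∈_; _⊆_; ∣_∣)
open import Data.Vec using (Vec; lookup; tabulate)
open import Data.List using (List; length; allFin)
open import Data.Bool.ListAction using (all; any)
open import Data.List.Relation.Unary.All using (All)
open import Data.List.Relation.Unary.Unique.Propositional using (Unique)
open import Data.Product using (Σ; ∃; _×_; _,_)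
open import Data.Sum using (_⊎_)
open import Relation.Nullary using (¬_; ⌊_⌋)
open import Relation.Unary using (Pred; _∪_; ｛_｝; _≐_)
open import Relation.Binary.PropositionalEquality using (_≡_; _≢_)

-- A table v is a permutation iff the map x ↦ v[x] is injective and
-- surjective (checked by a Boolean test, so the proof component is
-- proof-irrelevant and _≡_ on Perm n is equality of permutations).

isBijVec : ∀ {n} → Vec (Fin n) n → Bool
isBijVec {n} v =
  all (λ y → any (λ x → ⌊ lookup v x ≟ y ⌋) (allFin n)) (allFin n)
  ∧ all (λ x → all (λ y → if ⌊ lookup v x ≟ lookup v y ⌋ then ⌊ x ≟ y ⌋ else true)
                   (allFin n)) (allFin n)

record Perm (n : ℕ) : Set where
  constructor perm
  field
    vec    : Vec (Fin n) n
    isPerm : T (isBijVec vec)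
open Perm public

app : ∀ {n} → Perm n → Fin n → Fin n
app σ x = lookup (vec σ) x

iter : ∀ {n} → Perm n → ℕ → Fin n → Fin n
iter σ zero    x = x
iter σ (suc k) x = app σ (iter σ k x)

fix : ∀ {n} → Perm n → Subset n
fix σ = tabulate (λ x → ⌊ app σ x ≟ x ⌋)

-- A cycle of σ is determined by its support S, a σ-orbit
-- S = {σ^k(x) : k ∈ ℕ}, together with the restriction of σ to S.
-- The cycle of σ with support S also appears in τ iff τ agrees with σ on S.
-- (1-cycles, i.e. fixed points, are included.)

CommonCycle : ∀ {n} → Perm n → Perm n → Subset n → Set
CommonCycle σ τ S =
  Σ _ λ x → (∀ y → (y ∈ S → ∃ λ k → y ≡ iter σ k x)
                 × ((∃ λ k → y ≡ iter σ k x) → y ∈ S))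
          × (∀ y → y ∈ S → app σ y ≡ app τ y)

AtLeastCommonCycles : ∀ {n} → ℕ → Perm n → Perm n → Set
AtLeastCommonCycles t σ τ =
  ∃ λ (Ss : List (Subset _)) → length Ss ≡ t × Unique Ss × All (CommonCycle σ τ) Ss

Family : ℕ → Set₁
Family n = Pred (Perm n) 0ℓ

TCycleIntersecting : ∀ {n} → ℕ → Family n → Set
TCycleIntersecting t 𝒜 =
  ∀ σ τ → 𝒜 σ → 𝒜 τ → σ ≢ τ → AtLeastCommonCycles t σ τ

Maximal : ∀ {n} → ℕ → Family n → Set
Maximal t 𝒜 =
  TCycleIntersecting t 𝒜 × (∀ σ → ¬ 𝒜 σ → ¬ TCycleIntersecting t (𝒜 ∪ ｛ σ ｝))

-- ij-fixing: value table of _[ij]σ.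
-- If σ(i) = j: i ↦ i, σ⁻¹(i) ↦ j (σ⁻¹(i) is the unique x with σ x = i,
-- and x ≠ i since σ i = j ≠ i), everything else ↦ σ x.
ijFixVec : ∀ {n} → Fin n → Fin n → Perm n → Vec (Fin n) n
ijFixVec i j σ = tabulate f
  where
  f : _ → _
  f x = if ⌊ app σ i ≟ j ⌋
          then (if ⌊ x ≟ i ⌋ then i
                else (if ⌊ app σ x ≟ i ⌋ then j else app σ x))
          else app σ x

◁ : ∀ {n} → Fin n → Fin n → Family n → Family n
◁ i j 𝒜 ρ =
  ∃ λ σ → 𝒜 σ × ∃ λ τ → vec τ ≡ ijFixVec i j σ
                      × ((¬ 𝒜 τ × ρ ≡ τ) ⊎ (𝒜 τ × ρ ≡ σ))

Fixed : ∀ {n} → Family n → Set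
Fixed 𝒜 = ∀ i j → i ≢ j → ◁ i j 𝒜 ≐ 𝒜

𝒰p : ∀ {n} → Pred (Subset n) 0ℓ → Family n
𝒰p g σ = ∃ λ B → g B × B ⊆ fix σ

IsGeneratingSet : ∀ {n} → Pred (Subset n) 0ℓ → Family n → Set
IsGeneratingSet {n} g 𝒜 = (∀ B → g B → suc ∣ B ∣ ≢ n) × (𝒰p g ≐ 𝒜)

fixFam : ∀ {n} → Family n → Pred (Subset n) 0ℓ
fixFam 𝒜 B = ∃ λ σ → 𝒜 σ × fix σ ≡ B

{-# OPTIONS --safe #-}
module Submission where

open import Defs
open import Data.Nat using (ℕ; _≤_)
open import Relation.Unary using (Decidable)

open import Data.Bool using (Bool; true; false; T; if_then_else_)
open import Data.Bool.Properties using (T-∧; T-≡; T-irrelevant)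
open import Data.Bool.ListAction using (all; any)
open import Data.Fin using (Fin; _≟_)
open import Data.Fin.Properties using (any?; all?; ¬∀⟶∃¬)
open import Data.Fin.Subset using (Subset; _∈_; _∉_; _⊆_; _⊂_; _⊃_; _∪_; ⁅_⁆; ∣_∣)
open import Data.Fin.Subset.Properties
  using (⊆-antisym; ⊆⊤; p⊆p∪q; x∈p∪q⁺; x∈p∪q⁻; x∈⁅x⁆; x∈⁅y⁆⇒x≡y; _∈?_; p⊂q⇒∣p∣<∣q∣; ∣p∣≤n; ∣⊤∣≡n)
open import Data.Fin.Subset.Induction using (⊃-wellFounded)
open import Data.List using (allFin)
open import Data.List.Membership.Propositional using (lose)
open import Data.List.Membership.Propositional.Properties using (∈-allFin)
import Data.List.Relation.Unary.All as All
open import Data.List.Relation.Unary.All.Properties using (all⁺; all⁻; tabulate⁺)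
open import Data.List.Relation.Unary.Any using (satisfied)
open import Data.List.Relation.Unary.Any.Properties using (any⁺; any⁻)
open import Data.Nat using (zero; suc; _+_; s≤s)
open import Data.Nat.Properties using (≤-trans; <-≤-trans; ≤-reflexive; 1+n≰n)
open import Data.Product using (∃; _×_; _,_; proj₁; proj₂)
open import Data.Sum using (_⊎_; inj₁; inj₂)
open import Data.Vec using (Vec; lookup; tabulate)
open import Data.Vec.Properties
  using (lookup∘tabulate; tabulate∘lookup; tabulate-cong; ≡-dec; []=⇒lookup; lookup⇒[]=)
open import Function using (_⇔_; mk⇔; Equivalence)
open import Function.Definitions using (Injective; StrictlySurjective)
open import Induction.WellFounded using (Acc; acc)
open import Relation.Binary.Definitions using (DecidableEquality)
open import Relation.Binary.PropositionalEquality
  using (_≡_; _≢_; refl; sym; trans; cong; subst; ≢-sym; module ≡-Reasoning)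
open import Relation.Nullary using (¬_; ⌊_⌋; yes; no; Dec; contradiction; ¬?)
open import Relation.Nullary.Decidable
  using (isYes≗does; dec-true; dec-false; toWitness; fromWitness; _×-dec_; decidable-stable; map′)
open import Relation.Unary using (｛_｝) renaming (_∪_ to _∪ₚ_; _⊆_ to _⊆ₚ_)

-- Let σ ∈ 𝒜 and fix σ ⊆ fix τ.  By maximality it suffices to show that τ shares t cycles
-- with every ρ ∈ 𝒜.  While some point i is moved by σ and by ρ and ρ(i) is moved by σ,
-- replace ρ by its i ρ(i)-fixing: since 𝒜 is fixed this stays in 𝒜, it fixes one more point,
-- and its common fixed points with σ remain fixed by the original ρ.  The process ends at π ∈ 𝒜
-- mapping every point moved by both σ and π into fix σ, so σ and π share no cycle of
-- length > 1 (and π ≠ σ unless σ = id = τ).  Their t common cycles are therefore common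
-- fixed points of σ and π, hence fixed points of ρ and of τ.  Finally, no permutation fixes
-- exactly n − 1 points.

private variable
  n : ℕ

T-all-allFin : (p : Fin n → Bool) → T (all p (allFin n)) ⇔ (∀ x → T (p x))
T-all-allFin p = mk⇔ (λ h x → All.lookup (all⁺ p _ h) (∈-allFin x)) (λ h → all⁻ p (tabulate⁺ h))

T-any-allFin : (p : Fin n → Bool) → T (any p (allFin n)) ⇔ (∃ λ x → T (p x))
T-any-allFin p = mk⇔ (λ h → satisfied (any⁻ p (allFin _) h)) (λ (x , px) → any⁺ p (lose (∈-allFin x) px))

isBijVec⇒bijective : (v : Vec (Fin n) n) → T (isBijVec v) →
                     StrictlySurjective _≡_ (lookup v) × Injective _≡_ _≡_ (lookup v)
isBijVec⇒bijective v h = surjective , λ {x} {y} → injective x y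
  where
  bij = Equivalence.to T-∧ h
  surjective : StrictlySurjective _≡_ (lookup v)
  surjective y = let (x , vx≡y) = Equivalence.to (T-any-allFin _) (Equivalence.to (T-all-allFin _) (proj₁ bij) y)
                 in x , toWitness vx≡y
  injective : ∀ x y → lookup v x ≡ lookup v y → x ≡ y
  injective x y vx≡vy with Equivalence.to (T-all-allFin _) (Equivalence.to (T-all-allFin _) (proj₂ bij) x) y
  ... | x≡y? with lookup v x ≟ lookup v y
  ...   | yes _     = toWitness x≡y?
  ...   | no vx≢vy = contradiction vx≡vy vx≢vy

bijective⇒isBijVec : (v : Vec (Fin n) n) → StrictlySurjective _≡_ (lookup v) → Injective _≡_ _≡_ (lookup v) →
                     T (isBijVec v)
bijective⇒isBijVec v surjective injective = Equivalence.from T-∧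
  ( Equivalence.from (T-all-allFin _) (λ y → let (x , vx≡y) = surjective y in
      Equivalence.from (T-any-allFin _) (x , fromWitness vx≡y))
  , Equivalence.from (T-all-allFin _) λ x → Equivalence.from (T-all-allFin _) λ y → injectivity x y)
  where
  injectivity : ∀ x y → T (if ⌊ lookup v x ≟ lookup v y ⌋ then ⌊ x ≟ y ⌋ else true)
  injectivity x y with lookup v x ≟ lookup v y
  ... | yes vx≡vy = fromWitness (injective vx≡vy)
  ... | no _      = _

app-surjective : (σ : Perm n) → StrictlySurjective _≡_ (app σ)
app-surjective σ = proj₁ (isBijVec⇒bijective (vec σ) (isPerm σ))

app-injective : (σ : Perm n) → Injective _≡_ _≡_ (app σ)
app-injective σ = proj₂ (isBijVec⇒bijective (vec σ) (isPerm σ))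

vec-injective : {σ τ : Perm n} → vec σ ≡ vec τ → σ ≡ τ
vec-injective {σ = perm v p} {perm .v q} refl rewrite T-irrelevant p q = refl

app-ext : {σ τ : Perm n} → (∀ x → app σ x ≡ app τ x) → σ ≡ τ
app-ext {σ = σ} {τ} σ≗τ = vec-injective (begin
  vec σ                 ≡⟨ tabulate∘lookup (vec σ) ⟨
  tabulate (app σ)      ≡⟨ tabulate-cong σ≗τ ⟩
  tabulate (app τ)      ≡⟨ tabulate∘lookup (vec τ) ⟩
  vec τ                 ∎)
  where open ≡-Reasoning

_≟ₚ_ : DecidableEquality (Perm n)
σ ≟ₚ τ = map′ vec-injective (cong vec) (≡-dec _≟_ (vec σ) (vec τ))

∈-fix⁻ : (σ : Perm n) {x : Fin n} → x ∈ fix σ → app σ x ≡ x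
∈-fix⁻ σ {x} x∈fix =
  toWitness (Equivalence.from T-≡ (trans (sym (lookup∘tabulate _ x)) ([]=⇒lookup x∈fix)))

∈-fix⁺ : (σ : Perm n) {x : Fin n} → app σ x ≡ x → x ∈ fix σ
∈-fix⁺ σ {x} σx≡x =
  lookup⇒[]= x (fix σ) (trans (lookup∘tabulate _ x) (Equivalence.to T-≡ (fromWitness σx≡x)))

⌊⌋-true : {A : Set} (a? : Dec A) → A → ⌊ a? ⌋ ≡ true
⌊⌋-true a? a = trans (isYes≗does a?) (dec-true a? a)

⌊⌋-false : {A : Set} (a? : Dec A) → ¬ A → ⌊ a? ⌋ ≡ false
⌊⌋-false a? ¬a = trans (isYes≗does a?) (dec-false a? ¬a)

-- For j ≠ π i the ij-fixing of π is π itself, so only j = π i matters.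
module Fixing (π : Perm n) (i : Fin n) (i≢πi : i ≢ app π i) where

  fixed : Fin n → Fin n
  fixed = lookup (ijFixVec i (app π i) π)

  fixed-≡ : ∀ x → fixed x ≡ (if ⌊ app π i ≟ app π i ⌋
                               then (if ⌊ x ≟ i ⌋ then i else (if ⌊ app π x ≟ i ⌋ then app π i else app π x))
                               else app π x)
  fixed-≡ = lookup∘tabulate _

  fixed-i : fixed i ≡ i
  fixed-i rewrite fixed-≡ i | ⌊⌋-true (app π i ≟ app π i) refl | ⌊⌋-true (i ≟ i) refl = refl

  fixed-π⁻¹i : ∀ {x} → x ≢ i → app π x ≡ i → fixed x ≡ app π i
  fixed-π⁻¹i {x} x≢i πx≡i
    rewrite fixed-≡ x | ⌊⌋-true (app π i ≟ app π i) refl | ⌊⌋-false (x ≟ i) x≢i | ⌊⌋-true (app π x ≟ i) πx≡i = refl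

  fixed-elsewhere : ∀ {x} → x ≢ i → app π x ≢ i → fixed x ≡ app π x
  fixed-elsewhere {x} x≢i πx≢i
    rewrite fixed-≡ x | ⌊⌋-true (app π i ≟ app π i) refl | ⌊⌋-false (x ≟ i) x≢i | ⌊⌋-false (app π x ≟ i) πx≢i = refl

  data View (x : Fin n) : Set where
    at-i      : x ≡ i → View x
    at-π⁻¹i   : x ≢ i → app π x ≡ i → View x
    elsewhere : x ≢ i → app π x ≢ i → View x

  view : ∀ x → View x
  view x with x ≟ i | app π x ≟ i
  ... | yes x≡i | _        = at-i x≡i
  ... | no x≢i  | yes πx≡i = at-π⁻¹i x≢i πx≡i
  ... | no x≢i  | no πx≢i  = elsewhere x≢i πx≢i

  surjective : StrictlySurjective _≡_ fixed
  surjective y with app-surjective π y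
  ... | x , πx≡y with view x
  ...   | at-π⁻¹i _ πx≡i     = i , trans fixed-i (trans (sym πx≡i) πx≡y)
  ...   | elsewhere x≢i πx≢i = x , trans (fixed-elsewhere x≢i πx≢i) πx≡y
  ...   | at-i refl with app-surjective π i
  ...     | w , πw≡i = w , trans (fixed-π⁻¹i w≢i πw≡i) πx≡y
    where
    w≢i : w ≢ i
    w≢i refl = i≢πi (sym πw≡i)

  fixed≡i⇒≡i : ∀ {x} → fixed x ≡ i → x ≡ i
  fixed≡i⇒≡i {x} fx≡i with view x
  ... | at-i x≡i           = x≡i
  ... | at-π⁻¹i x≢i πx≡i   = contradiction (trans (sym fx≡i) (fixed-π⁻¹i x≢i πx≡i)) i≢πi
  ... | elsewhere x≢i πx≢i = contradiction (trans (sym (fixed-elsewhere x≢i πx≢i)) fx≡i) πx≢i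

  injective : Injective _≡_ _≡_ fixed
  injective {x} {y} fx≡fy with view x | view y
  ... | at-i refl | _         = sym (fixed≡i⇒≡i (trans (sym fx≡fy) fixed-i))
  ... | _         | at-i refl = fixed≡i⇒≡i (trans fx≡fy fixed-i)
  ... | at-π⁻¹i _ πx≡i | at-π⁻¹i _ πy≡i = app-injective π (trans πx≡i (sym πy≡i))
  ... | at-π⁻¹i x≢i πx≡i | elsewhere y≢i πy≢i = contradiction
          (app-injective π (trans (sym (fixed-π⁻¹i x≢i πx≡i)) (trans fx≡fy (fixed-elsewhere y≢i πy≢i)))) (≢-sym y≢i)
  ... | elsewhere x≢i πx≢i | at-π⁻¹i y≢i πy≡i = contradiction
          (app-injective π (trans (sym (fixed-elsewhere x≢i πx≢i)) (trans fx≡fy (fixed-π⁻¹i y≢i πy≡i)))) x≢i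
  ... | elsewhere x≢i πx≢i | elsewhere y≢i πy≢i =
          app-injective π (trans (sym (fixed-elsewhere x≢i πx≢i)) (trans fx≡fy (fixed-elsewhere y≢i πy≢i)))

  fixing : Perm n
  fixing = perm (ijFixVec i (app π i) π) (bijective⇒isBijVec (ijFixVec i (app π i) π) surjective injective)

  fix⊂fix-fixing : fix π ⊂ fix fixing
  fix⊂fix-fixing = (λ x∈fixπ → ∈-fix⁺ fixing (fixes-fix-π (∈-fix⁻ π x∈fixπ)))
                 , i , ∈-fix⁺ fixing fixed-i , λ i∈fixπ → i≢πi (sym (∈-fix⁻ π i∈fixπ))
    where
    fixes-fix-π : ∀ {x} → app π x ≡ x → fixed x ≡ x
    fixes-fix-π {x} πx≡x with view x
    ... | at-i refl          = fixed-i
    ... | at-π⁻¹i x≢i πx≡i   = contradiction (trans (sym πx≡x) πx≡i) x≢i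
    ... | elsewhere x≢i πx≢i = trans (fixed-elsewhere x≢i πx≢i) πx≡x

  fix-fixing∩fix⊆fix : (σ : Perm n) → app σ i ≢ i → app σ (app π i) ≢ app π i →
                       ∀ {x} → fixed x ≡ x → app σ x ≡ x → app π x ≡ x
  fix-fixing∩fix⊆fix σ σi≢i σπi≢πi {x} fx≡x σx≡x with view x
  ... | at-i refl          = contradiction σx≡x σi≢i
  ... | at-π⁻¹i x≢i πx≡i   =
          contradiction (subst (λ z → app σ z ≡ z) (trans (sym fx≡x) (fixed-π⁻¹i x≢i πx≡i)) σx≡x) σπi≢πi
  ... | elsewhere x≢i πx≢i = trans (sym (fixed-elsewhere x≢i πx≢i)) fx≡x

p⊂p∪⁅x⁆ : {p : Subset n} {x : Fin n} → x ∉ p → p ⊂ p ∪ ⁅ x ⁆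
p⊂p∪⁅x⁆ {x = x} x∉p = p⊆p∪q ⁅ x ⁆ , x , x∈p∪q⁺ (inj₂ (x∈⁅x⁆ x)) , x∉p

two-∉⇒2+∣p∣≤n : {p : Subset n} {x y : Fin n} → x ∉ p → y ∉ p → x ≢ y → 2 + ∣ p ∣ ≤ n
two-∉⇒2+∣p∣≤n {p = p} {x} {y} x∉p y∉p x≢y =
  ≤-trans (s≤s (p⊂q⇒∣p∣<∣q∣ (p⊂p∪⁅x⁆ x∉p)))
          (<-≤-trans (p⊂q⇒∣p∣<∣q∣ (p⊂p∪⁅x⁆ y∉p∪⁅x⁆)) (∣p∣≤n ((p ∪ ⁅ x ⁆) ∪ ⁅ y ⁆)))
  where
  y∉p∪⁅x⁆ : y ∉ p ∪ ⁅ x ⁆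
  y∉p∪⁅x⁆ y∈ with x∈p∪q⁻ p ⁅ x ⁆ y∈
  ... | inj₁ y∈p   = y∉p y∈p
  ... | inj₂ y∈⁅x⁆ = x≢y (sym (x∈⁅y⁆⇒x≡y x y∈⁅x⁆))

∀∈⇒∣p∣≡n : {p : Subset n} → (∀ x → x ∈ p) → ∣ p ∣ ≡ n
∀∈⇒∣p∣≡n {n} ∀∈ = trans (cong ∣_∣ (⊆-antisym ⊆⊤ (λ {x} _ → ∀∈ x))) (∣⊤∣≡n n)

suc∣fix∣≢n : (σ : Perm n) → suc ∣ fix σ ∣ ≢ n
suc∣fix∣≢n {n} σ 1+∣fix∣≡n with all? (_∈? fix σ)
... | yes ∀∈ = 1+n≰n (≤-reflexive (trans (cong suc (sym (∀∈⇒∣p∣≡n ∀∈))) 1+∣fix∣≡n))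
... | no ¬∀∈ with ¬∀⟶∃¬ n _ (_∈? fix σ) ¬∀∈
...   | y , y∉fix = 1+n≰n (subst (2 + ∣ fix σ ∣ ≤_) (sym 1+∣fix∣≡n) (two-∉⇒2+∣p∣≤n y∉fix σy∉fix y≢σy))
  where
  y≢σy : y ≢ app σ y
  y≢σy y≡σy = y∉fix (∈-fix⁺ σ (sym y≡σy))
  σy∉fix : app σ y ∉ fix σ
  σy∉fix σy∈fix = y≢σy (sym (app-injective σ (∈-fix⁻ σ σy∈fix)))

FixesCommonFixedPoints : Perm n → Perm n → Perm n → Set
FixesCommonFixedPoints ρ π σ = ∀ {x} → app π x ≡ x → app σ x ≡ x → app ρ x ≡ x

MovesIntoFix : Perm n → Perm n → Set
MovesIntoFix σ π = ∀ x → app σ x ≢ x → app π x ≢ x → app σ (app π x) ≡ app π x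

MovesIntoFix-self⇒fix : {σ : Perm n} → MovesIntoFix σ σ → ∀ x → app σ x ≡ x
MovesIntoFix-self⇒fix {σ = σ} moves x = decidable-stable (app σ x ≟ x) λ σx≢x →
  σx≢x (app-injective σ (moves x σx≢x σx≢x))

iter-fixed : (α : Perm n) {x : Fin n} → app α x ≡ x → ∀ k → iter α k x ≡ x
iter-fixed α αx≡x zero    = refl
iter-fixed α αx≡x (suc k) = trans (cong (app α) (iter-fixed α αx≡x k)) αx≡x

commonCycle-⁅⁆ : {α β : Perm n} {x : Fin n} → app α x ≡ x → app β x ≡ x → CommonCycle α β ⁅ x ⁆
commonCycle-⁅⁆ {α = α} {β} {x} αx≡x βx≡x = x , orbit , agree
  where
  orbit : ∀ y → (y ∈ ⁅ x ⁆ → ∃ λ k → y ≡ iter α k x) × ((∃ λ k → y ≡ iter α k x) → y ∈ ⁅ x ⁆)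
  orbit y = (λ y∈⁅x⁆ → 0 , x∈⁅y⁆⇒x≡y x y∈⁅x⁆)
          , λ (k , y≡αᵏx) → subst (_∈ ⁅ x ⁆) (sym (trans y≡αᵏx (iter-fixed α αx≡x k))) (x∈⁅x⁆ x)
  agree : ∀ y → y ∈ ⁅ x ⁆ → app α y ≡ app β y
  agree y y∈⁅x⁆ rewrite x∈⁅y⁆⇒x≡y x y∈⁅x⁆ = trans αx≡x (sym βx≡x)

commonCycle-MovesIntoFix : {σ π : Perm n} {S : Subset n} → MovesIntoFix σ π → CommonCycle π σ S →
                           ∃ λ x → app π x ≡ x × app σ x ≡ x × S ≡ ⁅ x ⁆
commonCycle-MovesIntoFix {σ = σ} {π} {S} moves (x , orbit , agree) =
  x , trans πx≡σx σx≡x , σx≡x , ⊆-antisym S⊆⁅x⁆ (λ y∈⁅x⁆ → subst (_∈ S) (sym (x∈⁅y⁆⇒x≡y x y∈⁅x⁆)) x∈S)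
  where
  x∈S : x ∈ S
  x∈S = proj₂ (orbit x) (0 , refl)
  πx≡σx : app π x ≡ app σ x
  πx≡σx = agree x x∈S
  σx≡x : app σ x ≡ x
  σx≡x = decidable-stable (app σ x ≟ x) λ σx≢x → σx≢x (app-injective σ
           (subst (λ z → app σ z ≡ z) πx≡σx (moves x σx≢x (λ πx≡x → σx≢x (trans (sym πx≡σx) πx≡x)))))
  S⊆⁅x⁆ : S ⊆ ⁅ x ⁆
  S⊆⁅x⁆ {y} y∈S with proj₁ (orbit y) y∈S
  ... | k , y≡πᵏx = subst (_∈ ⁅ x ⁆) (sym (trans y≡πᵏx (iter-fixed π (trans πx≡σx σx≡x) k))) (x∈⁅x⁆ x)

commonCycles-transfer : {t : ℕ} {σ π α β : Perm n} → MovesIntoFix σ π →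
                        FixesCommonFixedPoints α π σ → FixesCommonFixedPoints β π σ →
                        AtLeastCommonCycles t π σ → AtLeastCommonCycles t α β
commonCycles-transfer {σ = σ} {π} {α} {β} moves fixes-α fixes-β (Ss , length≡t , unique , cycles) =
  Ss , length≡t , unique , All.map transfer cycles
  where
  transfer : ∀ {S} → CommonCycle π σ S → CommonCycle α β S
  transfer c with commonCycle-MovesIntoFix {σ = σ} {π} moves c
  ... | x , πx≡x , σx≡x , refl = commonCycle-⁅⁆ {α = α} {β} (fixes-α πx≡x σx≡x) (fixes-β πx≡x σx≡x)

ClosedUnderFixing : Family n → Set
ClosedUnderFixing 𝒜 = ∀ π i (i≢πi : i ≢ app π i) → 𝒜 π → 𝒜 (Fixing.fixing π i i≢πi)

Fixed⇒ClosedUnderFixing : {𝒜 : Family n} → Decidable 𝒜 → Fixed 𝒜 → ClosedUnderFixing 𝒜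
Fixed⇒ClosedUnderFixing 𝒜? fixed π i i≢πi 𝒜π with 𝒜? (Fixing.fixing π i i≢πi)
... | yes 𝒜π′ = 𝒜π′
... | no ¬𝒜π′ = proj₁ (fixed i (app π i) i≢πi) (π , 𝒜π , Fixing.fixing π i i≢πi , refl , inj₁ (¬𝒜π′ , refl))

MovesIntoFix-or-violation : (σ π : Perm n) →
  MovesIntoFix σ π ⊎ ∃ λ x → app σ x ≢ x × app π x ≢ x × app σ (app π x) ≢ app π x
MovesIntoFix-or-violation σ π
  with any? (λ x → ¬? (app σ x ≟ x) ×-dec ¬? (app π x ≟ x) ×-dec ¬? (app σ (app π x) ≟ app π x))
... | yes violation = inj₂ violation
... | no ¬violation = inj₁ λ x σx≢x πx≢x → decidable-stable (app σ (app π x) ≟ app π x)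
                        λ σπx≢πx → ¬violation (x , σx≢x , πx≢x , σπx≢πx)

module _ {𝒜 : Family n} (closed : ClosedUnderFixing 𝒜) (σ ρ : Perm n) where

  reduce : ∀ π → Acc _⊃_ (fix π) → 𝒜 π → FixesCommonFixedPoints ρ π σ →
           ∃ λ π′ → 𝒜 π′ × FixesCommonFixedPoints ρ π′ σ × MovesIntoFix σ π′
  reduce π (acc smaller) 𝒜π invariant with MovesIntoFix-or-violation σ π
  ... | inj₁ moves = π , 𝒜π , invariant , moves
  ... | inj₂ (i , σi≢i , πi≢i , σπi≢πi) =
          reduce F.fixing (smaller F.fix⊂fix-fixing) (closed π i (≢-sym πi≢i) 𝒜π)
                 (λ fx≡x σx≡x → invariant (F.fix-fixing∩fix⊆fix σ σi≢i σπi≢πi fx≡x σx≡x) σx≡x)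
    where module F = Fixing π i (≢-sym πi≢i)

  reduce-to-MovesIntoFix : 𝒜 ρ → ∃ λ π → 𝒜 π × FixesCommonFixedPoints ρ π σ × MovesIntoFix σ π
  reduce-to-MovesIntoFix 𝒜ρ = reduce ρ (⊃-wellFounded (fix ρ)) 𝒜ρ (λ ρx≡x _ → ρx≡x)

fix-superset-intersects : {t : ℕ} {𝒜 : Family n} → ClosedUnderFixing 𝒜 → TCycleIntersecting t 𝒜 →
                          {σ ρ τ : Perm n} → 𝒜 σ → 𝒜 ρ → τ ≢ σ → fix σ ⊆ fix τ →
                          AtLeastCommonCycles t ρ τ × AtLeastCommonCycles t τ ρ
fix-superset-intersects {t = t} {𝒜} closed intersecting {σ} {ρ} {τ} 𝒜σ 𝒜ρ τ≢σ fixσ⊆fixτ =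
  intersects (reduce-to-MovesIntoFix closed σ ρ 𝒜ρ)
  where
  σ⊆τ : ∀ {x} → app σ x ≡ x → app τ x ≡ x
  σ⊆τ σx≡x = ∈-fix⁻ τ (fixσ⊆fixτ (∈-fix⁺ σ σx≡x))

  intersects : (∃ λ π → 𝒜 π × FixesCommonFixedPoints ρ π σ × MovesIntoFix σ π) →
               AtLeastCommonCycles t ρ τ × AtLeastCommonCycles t τ ρ
  intersects (π , 𝒜π , fixes-ρ , moves) with π ≟ₚ σ
  ... | yes refl = contradiction (app-ext λ x → trans (σ⊆τ (σ-id x)) (sym (σ-id x))) τ≢σ
    where
    σ-id : ∀ x → app σ x ≡ x
    σ-id = MovesIntoFix-self⇒fix {σ = σ} moves
  ... | no π≢σ = commonCycles-transfer {σ = σ} {π} {ρ} {τ} moves fixes-ρ (λ _ → σ⊆τ) common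
               , commonCycles-transfer {σ = σ} {π} {τ} {ρ} moves (λ _ → σ⊆τ) fixes-ρ common
    where
    common : AtLeastCommonCycles t π σ
    common = intersecting π σ 𝒜π 𝒜σ π≢σ

∪｛｝-intersecting : {t : ℕ} {𝒜 : Family n} {τ : Perm n} → TCycleIntersecting t 𝒜 →
                    (∀ ρ → 𝒜 ρ → AtLeastCommonCycles t ρ τ × AtLeastCommonCycles t τ ρ) →
                    TCycleIntersecting t (𝒜 ∪ₚ ｛ τ ｝)
∪｛｝-intersecting intersecting with-τ α β (inj₁ 𝒜α) (inj₁ 𝒜β) α≢β = intersecting α β 𝒜α 𝒜β α≢β
∪｛｝-intersecting intersecting with-τ α β (inj₁ 𝒜α) (inj₂ refl) _   = proj₁ (with-τ α 𝒜α)
∪｛｝-intersecting intersecting with-τ α β (inj₂ refl) (inj₁ 𝒜β) _   = proj₂ (with-τ β 𝒜β)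
∪｛｝-intersecting intersecting with-τ α β (inj₂ refl) (inj₂ refl) α≢α = contradiction refl α≢α

lemma2p8 : ∀ {n : ℕ} (t : ℕ) → 1 ≤ t → (𝒜 : Family n) → Decidable 𝒜 →
           Maximal t 𝒜 → Fixed 𝒜 → IsGeneratingSet (fixFam 𝒜) 𝒜
lemma2p8 t _ 𝒜 𝒜? (intersecting , maximal) fixed =
  (λ { _ (σ , _ , refl) → suc∣fix∣≢n σ }) , 𝒰p⊆𝒜 , λ {σ} 𝒜σ → fix σ , (σ , 𝒜σ , refl) , λ x∈fix → x∈fix
  where
  𝒰p⊆𝒜 : 𝒰p (fixFam 𝒜) ⊆ₚ 𝒜
  𝒰p⊆𝒜 {τ} (_ , (σ , 𝒜σ , refl) , fixσ⊆fixτ) with 𝒜? τ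
  ... | yes 𝒜τ = 𝒜τ
  ... | no ¬𝒜τ = contradiction
    (∪｛｝-intersecting intersecting λ ρ 𝒜ρ →
       fix-superset-intersects (Fixed⇒ClosedUnderFixing 𝒜? fixed) intersecting {τ = τ} 𝒜σ 𝒜ρ
         (λ τ≡σ → ¬𝒜τ (subst 𝒜 (sym τ≡σ) 𝒜σ)) fixσ⊆fixτ)
    (maximal τ ¬𝒜τ)
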